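{- For every positive integer $m$, the graph $H_{2m}$ contains a buffered path of length $f(m)$ from $\{x_1,\dots,x_{2m}\}$ to $\{y_1,\dots,y_{2m}\}$.
   Context: Let $L_i=\{x_i,y_i\}$ be pairwise disjoint two-element sets and $E_n=L_1\cup\dots\cup L_n$. A transversal is a set $\{z_1,\dots,z_n\}$ with $z_i\in\{x_i,y_i\}$ for each $i$. $H_n$ is the graph whose vertices are the transversals, two transversals being adjacent (neighbours) when they differ in exactly one element. A path $X_0,X_1,\dots,X_k$ in $H_n$ is buffered if $X_k=E_n-X_0$ and the only pairs $i,j$ for which $X_i$ is a neighbour of $X_j$ or of $E_n-X_j$ are those with $j=i\pm1$, or $\{i,j\}=\{1,k\}$, or $\{i,j\}=\{0,k-1\}$; $k$ is its length. Define $f(m)=\frac{2^{m+1}+2}{3}$ if $m$ is odd and $f(m)=\frac{2^{m+1}+4}{3}$ if $m$ is even. -}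

module Defs where

open import Data.Nat using (ℕ; zero; suc; _+_; _*_; _^_; _≤_; _<_)
open import Data.Nat.DivMod using (_/_; _%_)
open import Data.Bool using (Bool; true; false; not; if_then_else_)
open import Data.Vec using (Vec; []; _∷_; map; replicate)
open import Data.Sum using (_⊎_)
open import Data.Product using (_×_)
open import Relation.Binary.PropositionalEquality using (_≡_; _≢_)

-- A transversal of E_n = L_1 ∪ … ∪ L_n is encoded as a Vec Bool n:
-- coordinate i is false when z_i = x_i and true when z_i = y_i.
Transversal : ℕ → Set
Transversal n = Vec Bool n

allX : (n : ℕ) → Transversal n
allX n = replicate n false

allY : (n : ℕ) → Transversal n
allY n = replicate n true

-- E_n − X (again a transversal): swap every x_i / y_i
complement : {n : ℕ} → Transversal n → Transversal n
complement = map not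

diffCount : {n : ℕ} → Transversal n → Transversal n → ℕ
diffCount [] [] = 0
diffCount (a ∷ as) (b ∷ bs) = (if a Data.Bool.xor b then 1 else 0) + diffCount as bs

Neighbour : {n : ℕ} → Transversal n → Transversal n → Set
Neighbour X Y = diffCount X Y ≡ 1

-- A path X_0,…,X_k in H_n (sequence given as ℕ → Transversal n, only
-- indices 0..k matter): distinct vertices, consecutive ones adjacent.
IsPath : {n : ℕ} → (k : ℕ) → (ℕ → Transversal n) → Set
IsPath k X =
  (∀ i → i < k → Neighbour (X i) (X (suc i))) ×
  (∀ i j → i ≤ k → j ≤ k → X i ≡ X j → i ≡ j)

AllowedPair : ℕ → ℕ → ℕ → Set
AllowedPair k i j =
  (j ≡ suc i) ⊎ (i ≡ suc j) ⊎
  ((i ≡ 1) × (j ≡ k)) ⊎ ((i ≡ k) × (j ≡ 1)) ⊎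
  ((i ≡ 0) × (j ≡ k Data.Nat.∸ 1)) ⊎ ((i ≡ k Data.Nat.∸ 1) × (j ≡ 0))

IsBuffered : {n : ℕ} → (k : ℕ) → (ℕ → Transversal n) → Set
IsBuffered {n} k X =
  IsPath k X ×
  (X k ≡ complement (X 0)) ×
  (∀ i j → i ≤ k → j ≤ k →
     (Neighbour (X i) (X j) ⊎ Neighbour (X i) (complement (X j))) →
     AllowedPair k i j)

f : ℕ → ℕ
f m with m % 2
... | 0 = (2 ^ (m + 1) + 4) / 3
... | _ = (2 ^ (m + 1) + 2) / 3

module Submission where

-- We carry a stronger invariant than "buffered": a *framed*
-- path is a buffered path from all-x to all-y whose only antipodal pair X_p = E_n − X_r
-- is its pair of endpoints. The monotone path (switch coordinates to y one at a time) is
-- a framed path of length n in H_n. The key step extends a framed path X of length K in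
-- H_n (n ≠ 2) by two coordinates: for D = 2 + 4q ≤ K a staircase walk j ↦ (a j , p j)
-- interleaves D steps around the 4-cycle of H_2 with the K steps of X, and
-- Y_j = gray (a j) ++ X (p j) is a framed path of length K + D in H_(n+2). Distances split
-- over the two blocks, so close pairs of Y come from close pairs of X, which for n ≠ 2
-- sit at rows 0, 1, K − 1, K; there the walk is pinned down and D ≡ 2 (mod 4) lets only
-- the allowed pairs of Y survive. Alternating D = K − 2 and D = K from the monotone
-- paths in H_2 and H_4 yields lengths 2 + 4w and 4 + 8w with w = (4^k − 1)/3, which
-- are f(2k+1) and f(2k+2).

open import Defs
open import Data.Nat using (ℕ; suc; _*_)
open import Data.Product using (Σ; _×_)
open import Relation.Binary.PropositionalEquality using (_≡_)
open import Data.Nat using (zero; _+_; _∸_; _^_; _≤_; _<_; _≤?_; _<?_; z≤n; s≤s; s≤s⁻¹; ∣_-_∣)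
open import Data.Nat.Properties
open import Data.Bool using (Bool; true; false; not; _xor_; if_then_else_)
open import Data.Vec using (Vec; []; _∷_; _++_)
open import Data.Vec.Properties using (map-replicate; map-++)
open import Data.Nat.DivMod using (_/_; _%_; [m+kn]%n≡m%n; m*n/n≡m)
open import Data.Nat.Tactic.RingSolver using (solve-∀)
open import Data.Product using (_,_; proj₁; proj₂)
open import Data.Sum using (_⊎_; inj₁; inj₂; [_,_]′)
open import Relation.Nullary using (¬_; yes; no)
open import Data.Empty using (⊥; ⊥-elim)
open import Relation.Nullary.Negation using (contradiction)
open import Relation.Binary.PropositionalEquality
  using (_≢_; refl; sym; trans; cong; cong₂; subst; subst₂; module ≡-Reasoning)

diffCount-++ : ∀ {m n} (u u′ : Vec Bool m) (v v′ : Vec Bool n) →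
  diffCount (u ++ v) (u′ ++ v′) ≡ diffCount u u′ + diffCount v v′
diffCount-++ [] [] v v′ = refl
diffCount-++ (a ∷ u) (b ∷ u′) v v′ =
  trans (cong ((if a xor b then 1 else 0) +_) (diffCount-++ u u′ v v′))
        (sym (+-assoc (if a xor b then 1 else 0) (diffCount u u′) (diffCount v v′)))

diffCount-self : ∀ {n} (u : Vec Bool n) → diffCount u u ≡ 0
diffCount-self [] = refl
diffCount-self (false ∷ u) = diffCount-self u
diffCount-self (true ∷ u) = diffCount-self u

diffCount≡0⇒≡ : ∀ {n} (u v : Vec Bool n) → diffCount u v ≡ 0 → u ≡ v
diffCount≡0⇒≡ [] [] _ = refl
diffCount≡0⇒≡ (false ∷ u) (false ∷ v) e = cong (false ∷_) (diffCount≡0⇒≡ u v e)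
diffCount≡0⇒≡ (true ∷ u) (true ∷ v) e = cong (true ∷_) (diffCount≡0⇒≡ u v e)

diffCount-sym : ∀ {n} (u v : Vec Bool n) → diffCount u v ≡ diffCount v u
diffCount-sym [] [] = refl
diffCount-sym (false ∷ u) (false ∷ v) = diffCount-sym u v
diffCount-sym (true ∷ u) (true ∷ v) = diffCount-sym u v
diffCount-sym (false ∷ u) (true ∷ v) = cong suc (diffCount-sym u v)
diffCount-sym (true ∷ u) (false ∷ v) = cong suc (diffCount-sym u v)

-- Each coordinate of u disagrees with exactly one of v, E_n − v.
diffCount-complement : ∀ {n} (u v : Vec Bool n) →
  diffCount u (complement v) + diffCount u v ≡ n
diffCount-complement [] [] = refl
diffCount-complement (false ∷ u) (false ∷ v) = cong suc (diffCount-complement u v)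
diffCount-complement (true ∷ u) (true ∷ v) = cong suc (diffCount-complement u v)
diffCount-complement (false ∷ u) (true ∷ v) =
  trans (+-suc _ _) (cong suc (diffCount-complement u v))
diffCount-complement (true ∷ u) (false ∷ v) =
  trans (+-suc _ _) (cong suc (diffCount-complement u v))

-- In H_n with n ≠ 2 no transversal is a neighbour of both v and E_n − v,
-- since its distances to v and to E_n − v add up to n.
not-both-neighbours : ∀ {n} → n ≢ 2 → (u v : Transversal n) →
  Neighbour u v → Neighbour u (complement v) → ⊥
not-both-neighbours n≢2 u v u∼v u∼v̄ =
  n≢2 (trans (sym (diffCount-complement u v)) (cong₂ _+_ u∼v̄ u∼v))

allY≡complement-allX : ∀ {n} {u v : Transversal n} → u ≡ allX n → v ≡ allY n → v ≡ complement u
allY≡complement-allX {n} refl refl = sym (map-replicate not false n)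

Adjacent : ℕ → ℕ → Set
Adjacent i j = j ≡ suc i ⊎ i ≡ suc j

NearEnds : ℕ → ℕ → ℕ → Set
NearEnds k i j =
  ((i ≡ 1) × (j ≡ k)) ⊎ ((i ≡ k) × (j ≡ 1)) ⊎
  ((i ≡ 0) × (j ≡ k ∸ 1)) ⊎ ((i ≡ k ∸ 1) × (j ≡ 0))

adjacent⇒allowed : ∀ {k i j} → Adjacent i j → AllowedPair k i j
adjacent⇒allowed (inj₁ e) = inj₁ e
adjacent⇒allowed (inj₂ e) = inj₂ (inj₁ e)

near-ends⇒allowed : ∀ {k i j} → NearEnds k i j → AllowedPair k i j
near-ends⇒allowed ends = inj₂ (inj₂ ends)

gray : ℕ → Vec Bool 2
gray 0 = false ∷ false ∷ []
gray 1 = false ∷ true ∷ []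
gray 2 = true ∷ true ∷ []
gray 3 = true ∷ false ∷ []
gray (suc (suc (suc (suc a)))) = gray a

gray-step : ∀ a → Neighbour (gray a) (gray (suc a))
gray-step 0 = refl
gray-step 1 = refl
gray-step 2 = refl
gray-step 3 = refl
gray-step (suc (suc (suc (suc a)))) = gray-step a

gray-antipode : ∀ a → complement (gray a) ≡ gray (2 + a)
gray-antipode 0 = refl
gray-antipode 1 = refl
gray-antipode 2 = refl
gray-antipode 3 = refl
gray-antipode (suc (suc (suc (suc a)))) = gray-antipode a

gray-moves₁ : ∀ a → gray a ≢ gray (1 + a)
gray-moves₁ 0 ()
gray-moves₁ 1 ()
gray-moves₁ 2 ()
gray-moves₁ 3 ()
gray-moves₁ (suc (suc (suc (suc a)))) = gray-moves₁ a

gray-moves₂ : ∀ a → gray a ≢ gray (2 + a)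
gray-moves₂ 0 ()
gray-moves₂ 1 ()
gray-moves₂ 2 ()
gray-moves₂ 3 ()
gray-moves₂ (suc (suc (suc (suc a)))) = gray-moves₂ a

gray-periodic : ∀ a q → gray (a + q * 4) ≡ gray a
gray-periodic a zero = cong gray (+-identityʳ a)
gray-periodic a (suc q) = trans (cong gray (shift a (q * 4))) (gray-periodic a q)
  where
  shift : ∀ a x → a + (4 + x) ≡ 4 + (a + x)
  shift a x = trans (sym (+-assoc a 4 x)) (trans (cong (_+ x) (+-comm a 4)) (+-assoc 4 a x))

gray-top : ∀ q {x} → x ≡ 2 + q * 4 → gray x ≡ gray 2 × gray (2 + x) ≡ gray 0
gray-top q refl = gray-periodic 2 q , gray-periodic 0 q

gray-below-top : ∀ q {x} → suc x ≡ 2 + q * 4 → gray x ≡ gray 1 × gray (2 + x) ≡ gray 3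
gray-below-top q refl = gray-periodic 1 q , gray-periodic 3 q

∣i-j∣≡1⇒adjacent : ∀ i j → ∣ i - j ∣ ≡ 1 → Adjacent i j
∣i-j∣≡1⇒adjacent zero j e = inj₁ e
∣i-j∣≡1⇒adjacent (suc i) zero e = inj₂ e
∣i-j∣≡1⇒adjacent (suc i) (suc j) e with ∣i-j∣≡1⇒adjacent i j e
... | inj₁ e′ = inj₁ (cong suc e′)
... | inj₂ e′ = inj₂ (cong suc e′)

∣i-j∣≡n⇒ends : ∀ {n} i j → i ≤ n → j ≤ n → ∣ i - j ∣ ≡ n →
  (i ≡ 0 × j ≡ n) ⊎ (i ≡ n × j ≡ 0)
∣i-j∣≡n⇒ends zero j _ _ e = inj₁ (refl , e)
∣i-j∣≡n⇒ends (suc i) zero _ _ e = inj₂ (e , refl)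
∣i-j∣≡n⇒ends (suc i) (suc j) i<n j<n refl =
  contradiction (≤-trans (s≤s (∣m-n∣≤m⊔n i j)) (⊔-lub i<n j<n)) (<-irrefl refl)

suc∣i-j∣≡n⇒near-ends : ∀ {n} i j → i ≤ n → j ≤ n → suc ∣ i - j ∣ ≡ n → NearEnds n i j
suc∣i-j∣≡n⇒near-ends zero j _ _ refl = inj₂ (inj₂ (inj₁ (refl , refl)))
suc∣i-j∣≡n⇒near-ends (suc i) zero _ _ refl = inj₂ (inj₂ (inj₂ (refl , refl)))
suc∣i-j∣≡n⇒near-ends (suc i) (suc j) (s≤s i≤m) (s≤s j≤m) refl
  with ∣i-j∣≡n⇒ends i j i≤m j≤m refl
... | inj₁ (i≡0 , j≡m) = inj₁ (cong suc i≡0 , cong suc j≡m)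
... | inj₂ (i≡m , j≡0) = inj₂ (inj₁ (cong suc i≡m , cong suc j≡0))

ascending : (n : ℕ) → ℕ → Transversal n
ascending zero _ = []
ascending (suc n) zero = false ∷ ascending n zero
ascending (suc n) (suc i) = true ∷ ascending n i

ascending-start : ∀ n → ascending n 0 ≡ allX n
ascending-start zero = refl
ascending-start (suc n) = cong (false ∷_) (ascending-start n)

ascending-end : ∀ n → ascending n n ≡ allY n
ascending-end zero = refl
ascending-end (suc n) = cong (true ∷_) (ascending-end n)

ascending-distance : ∀ n i j → i ≤ n → j ≤ n →
  diffCount (ascending n i) (ascending n j) ≡ ∣ i - j ∣
ascending-distance zero zero zero _ _ = refl
ascending-distance (suc n) zero zero _ _ = ascending-distance n 0 0 z≤n z≤n
ascending-distance (suc n) zero (suc j) _ (s≤s j≤n) =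
  cong suc (ascending-distance n 0 j z≤n j≤n)
ascending-distance (suc n) (suc i) zero (s≤s i≤n) _ =
  cong suc (trans (ascending-distance n i 0 i≤n z≤n) (∣-∣-identityʳ i))
ascending-distance (suc n) (suc i) (suc j) (s≤s i≤n) (s≤s j≤n) =
  ascending-distance n i j i≤n j≤n

-- A buffered path from {x_1,…,x_n} to {y_1,…,y_n} whose endpoints are its only
-- antipodal pair (X_p = E_n − X_r); this is the invariant carried through the induction.
record FramedPath (n K : ℕ) : Set where
  field
    vertex    : ℕ → Transversal n
    buffered  : IsBuffered K vertex
    starts    : vertex 0 ≡ allX n
    ends      : vertex K ≡ allY n
    antipodes : ∀ p r → p ≤ K → r ≤ K → vertex p ≡ complement (vertex r) →
                (p ≡ 0 × r ≡ K) ⊎ (p ≡ K × r ≡ 0)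

-- The monotone path is a framed path of length n in H_n: by ascending-distance,
-- neighbours are consecutive indices and X_i, E_n − X_j are at distance n − ∣i − j∣.
ascendingPath : ∀ n → FramedPath n n
ascendingPath n = record
  { vertex = X
  ; buffered = ((step , injective) , antipodal-ends , close)
  ; starts = ascending-start n
  ; ends = ascending-end n
  ; antipodes = antipodes }
  where
  X : ℕ → Transversal n
  X = ascending n

  distance : ∀ i j → i ≤ n → j ≤ n → diffCount (X i) (X j) ≡ ∣ i - j ∣
  distance = ascending-distance n

  antidistance : ∀ i j → i ≤ n → j ≤ n →
    diffCount (X i) (complement (X j)) + ∣ i - j ∣ ≡ n
  antidistance i j i≤n j≤n =
    trans (cong (diffCount (X i) (complement (X j)) +_) (sym (distance i j i≤n j≤n)))
          (diffCount-complement (X i) (X j))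

  step : ∀ i → i < n → Neighbour (X i) (X (suc i))
  step i i<n = trans (distance i (suc i) (<⇒≤ i<n) i<n)
                     (trans (cong (λ k → ∣ i - k ∣) (+-comm 1 i)) (∣m-m+n∣≡n i 1))

  injective : ∀ i j → i ≤ n → j ≤ n → X i ≡ X j → i ≡ j
  injective i j i≤n j≤n Xi≡Xj = ∣m-n∣≡0⇒m≡n
    (trans (sym (distance i j i≤n j≤n))
           (trans (cong (diffCount (X i)) (sym Xi≡Xj)) (diffCount-self (X i))))

  antipodal-ends : X n ≡ complement (X 0)
  antipodal-ends = allY≡complement-allX (ascending-start n) (ascending-end n)

  close : ∀ i j → i ≤ n → j ≤ n →
    (Neighbour (X i) (X j) ⊎ Neighbour (X i) (complement (X j))) → AllowedPair n i j
  close i j i≤n j≤n (inj₁ Xi∼Xj) =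
    adjacent⇒allowed (∣i-j∣≡1⇒adjacent i j (trans (sym (distance i j i≤n j≤n)) Xi∼Xj))
  close i j i≤n j≤n (inj₂ Xi∼X̄j) =
    near-ends⇒allowed (suc∣i-j∣≡n⇒near-ends i j i≤n j≤n
      (trans (cong (_+ ∣ i - j ∣) (sym Xi∼X̄j)) (antidistance i j i≤n j≤n)))

  antipodes : ∀ p r → p ≤ n → r ≤ n → X p ≡ complement (X r) →
    (p ≡ 0 × r ≡ n) ⊎ (p ≡ n × r ≡ 0)
  antipodes p r p≤n r≤n Xp≡X̄r = ∣i-j∣≡n⇒ends p r p≤n r≤n
    (trans (cong (_+ ∣ p - r ∣) (sym Xp∼X̄r≡0)) (antidistance p r p≤n r≤n))
    where
    Xp∼X̄r≡0 : diffCount (X p) (complement (X r)) ≡ 0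
    Xp∼X̄r≡0 = trans (cong (diffCount (X p)) (sym Xp≡X̄r)) (diffCount-self (X p))

suc[k∸1]≡k : ∀ {k} → 1 ≤ k → suc (k ∸ 1) ≡ k
suc[k∸1]≡k (s≤s z≤n) = refl

-- The excluded cases would make some vertex a neighbour of both v and E_n − v.
module BufferedPath {n K : ℕ} {X : ℕ → Transversal n}
                    (n≢2 : n ≢ 2) (1≤K : 1 ≤ K) (B : IsBuffered K X) where

  private
    step : ∀ i → i < K → Neighbour (X i) (X (suc i))
    step = proj₁ (proj₁ B)

    antipodal-ends : X K ≡ complement (X 0)
    antipodal-ends = proj₁ (proj₂ B)

    close : ∀ i j → i ≤ K → j ≤ K →
      (Neighbour (X i) (X j) ⊎ Neighbour (X i) (complement (X j))) → AllowedPair K i j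
    close = proj₂ (proj₂ B)

    symmetric : (u v : Transversal n) → Neighbour u v → Neighbour v u
    symmetric u v u∼v = trans (diffCount-sym v u) u∼v

    not-near-both-ends : (u : Transversal n) → Neighbour u (X 0) → Neighbour u (X K) → ⊥
    not-near-both-ends u u∼X₀ u∼X_K =
      not-both-neighbours n≢2 u (X 0) u∼X₀ (subst (Neighbour u) antipodal-ends u∼X_K)

    second∼first : Neighbour (X 1) (X 0)
    second∼first = symmetric (X 0) (X 1) (step 0 1≤K)

    penultimate∼first : Neighbour (X (K ∸ 1)) (X 0) → ⊥
    penultimate∼first nb = not-near-both-ends (X (K ∸ 1)) nb
      (subst (λ k → Neighbour (X (K ∸ 1)) (X k)) (suc[k∸1]≡k 1≤K)
        (step (K ∸ 1) (subst (K ∸ 1 <_) (suc[k∸1]≡k 1≤K) ≤-refl)))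

  neighbours-adjacent : ∀ i j → i ≤ K → j ≤ K → Neighbour (X i) (X j) → Adjacent i j
  neighbours-adjacent i j i≤K j≤K Xi∼Xj with close i j i≤K j≤K (inj₁ Xi∼Xj)
  ... | inj₁ e = inj₁ e
  ... | inj₂ (inj₁ e) = inj₂ e
  ... | inj₂ (inj₂ (inj₁ (refl , refl))) = ⊥-elim (not-near-both-ends (X 1) second∼first Xi∼Xj)
  ... | inj₂ (inj₂ (inj₂ (inj₁ (refl , refl)))) =
    ⊥-elim (not-near-both-ends (X 1) second∼first (symmetric (X K) (X 1) Xi∼Xj))
  ... | inj₂ (inj₂ (inj₂ (inj₂ (inj₁ (refl , refl))))) =
    ⊥-elim (penultimate∼first (symmetric (X 0) (X (K ∸ 1)) Xi∼Xj))
  ... | inj₂ (inj₂ (inj₂ (inj₂ (inj₂ (refl , refl))))) = ⊥-elim (penultimate∼first Xi∼Xj)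

  antineighbours-near-ends : ∀ i j → i ≤ K → j ≤ K → Neighbour (X i) (complement (X j)) →
    NearEnds K i j
  antineighbours-near-ends i j i≤K j≤K Xi∼X̄j with close i j i≤K j≤K (inj₂ Xi∼X̄j)
  ... | inj₁ refl = ⊥-elim (not-both-neighbours n≢2 (X i) (X j) (step i j≤K) Xi∼X̄j)
  ... | inj₂ (inj₁ refl) =
    ⊥-elim (not-both-neighbours n≢2 (X i) (X j) (symmetric (X j) (X i) (step j i≤K)) Xi∼X̄j)
  ... | inj₂ (inj₂ ends) = ends

sum≡1 : ∀ x y → x + y ≡ 1 → (x ≡ 0 × y ≡ 1) ⊎ (x ≡ 1 × y ≡ 0)
sum≡1 zero y e = inj₁ (refl , e)
sum≡1 (suc zero) zero e = inj₂ (refl , refl)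

squeeze₁ : ∀ {x y} → x ≤ y → y ≤ suc x → y ≡ x ⊎ y ≡ suc x
squeeze₁ x≤y y≤1+x with m≤n⇒m<n∨m≡n y≤1+x
... | inj₁ y<1+x = inj₁ (≤-antisym (s≤s⁻¹ y<1+x) x≤y)
... | inj₂ y≡1+x = inj₂ y≡1+x

squeeze₂ : ∀ {x y} → x ≤ y → y ≤ 2 + x → y ≡ x ⊎ y ≡ suc x ⊎ y ≡ 2 + x
squeeze₂ x≤y y≤2+x with m≤n⇒m<n∨m≡n y≤2+x
... | inj₁ y<2+x = [ inj₁ , (λ e → inj₂ (inj₁ e)) ]′ (squeeze₁ x≤y (s≤s⁻¹ y<2+x))
... | inj₂ y≡2+x = inj₂ (inj₂ y≡2+x)

-- The staircase walk in ℕ × ℕ that interleaves the 4-cycle (coordinate a) with a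
-- path (coordinate p): from (0,0) it alternately steps in a and in p, keeping
-- p ≤ a ≤ p + 1, until a reaches D, and from then on steps only in p.
module Staircase (D : ℕ) where

  advance : ℕ × ℕ → ℕ × ℕ
  advance (a , p) with a ≤? p | a <? D
  ... | yes _ | yes _ = suc a , p
  ... | _     | _     = a , suc p

  position : ℕ → ℕ × ℕ
  position zero = 0 , 0
  position (suc j) = advance (position j)

  a p : ℕ → ℕ
  a j = proj₁ (position j)
  p j = proj₂ (position j)

  step-cases : ∀ j →
    (a (suc j) ≡ suc (a j) × p (suc j) ≡ p j × a j ≤ p j × a j < D) ⊎
    (a (suc j) ≡ a j × p (suc j) ≡ suc (p j) × (¬ a j ≤ p j ⊎ ¬ a j < D))
  step-cases j with a j ≤? p j | a j <? D
  ... | yes a≤p | yes a<D = inj₁ (refl , refl , a≤p , a<D)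
  ... | yes _   | no a≮D  = inj₂ (refl , refl , inj₂ a≮D)
  ... | no a≰p  | _       = inj₂ (refl , refl , inj₁ a≰p)

  a+p≡j : ∀ j → a j + p j ≡ j
  a+p≡j zero = refl
  a+p≡j (suc j) with step-cases j
  ... | inj₁ (ea , ep , _) rewrite ea | ep = cong suc (a+p≡j j)
  ... | inj₂ (ea , ep , _) rewrite ea | ep = trans (+-suc (a j) (p j)) (cong suc (a+p≡j j))

  a≤D : ∀ j → a j ≤ D
  a≤D zero = z≤n
  a≤D (suc j) with step-cases j
  ... | inj₁ (ea , _ , _ , a<D) rewrite ea = a<D
  ... | inj₂ (ea , _) rewrite ea = a≤D j

  a≤1+p : ∀ j → a j ≤ suc (p j)
  a≤1+p zero = z≤n
  a≤1+p (suc j) with step-cases j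
  ... | inj₁ (ea , ep , a≤p , _) rewrite ea | ep = s≤s a≤p
  ... | inj₂ (ea , ep , _) rewrite ea | ep = m≤n⇒m≤1+n (a≤1+p j)

  a<D⇒p≤a : ∀ j → a j < D → p j ≤ a j
  a<D⇒p≤a zero _ = z≤n
  a<D⇒p≤a (suc j) a<D with step-cases j
  ... | inj₁ (ea , ep , _ , a<D′) rewrite ea | ep = m≤n⇒m≤1+n (a<D⇒p≤a j a<D′)
  ... | inj₂ (ea , ep , inj₁ a≰p) rewrite ea | ep = ≰⇒> a≰p
  ... | inj₂ (ea , ep , inj₂ a≮D) rewrite ea = contradiction a<D a≮D

  monotone : ∀ {i j} → i ≤ j → a i ≤ a j × p i ≤ p j
  monotone {j = zero} z≤n = ≤-refl , ≤-refl
  monotone {i} {suc j} i≤1+j with m≤n⇒m<n∨m≡n i≤1+j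
  ... | inj₂ refl = ≤-refl , ≤-refl
  ... | inj₁ i<1+j with monotone (s≤s⁻¹ i<1+j) | step-cases j
  ...   | aᵢ≤aⱼ , pᵢ≤pⱼ | inj₁ (ea , ep , _) rewrite ea | ep = m≤n⇒m≤1+n aᵢ≤aⱼ , pᵢ≤pⱼ
  ...   | aᵢ≤aⱼ , pᵢ≤pⱼ | inj₂ (ea , ep , _) rewrite ea | ep = aᵢ≤aⱼ , m≤n⇒m≤1+n pᵢ≤pⱼ

  index : ∀ j {x y} → a j ≡ x → p j ≡ y → j ≡ x + y
  index j ea ep = trans (sym (a+p≡j j)) (cong₂ _+_ ea ep)

  on-top : ∀ j → D ≤ p j → a j ≡ D
  on-top j D≤p with a j <? D
  ... | yes a<D = contradiction (≤-trans a<D D≤p) (≤⇒≯ (a<D⇒p≤a j a<D))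
  ... | no a≮D = ≤-antisym (a≤D j) (≮⇒≥ a≮D)

  near-top : ∀ j → D ≤ suc (p j) → a j ≡ D ⊎ suc (a j) ≡ D
  near-top j D≤1+p with a j <? D
  ... | yes a<D = inj₂ (≤-antisym a<D (≤-trans D≤1+p (s≤s (a<D⇒p≤a j a<D))))
  ... | no a≮D = inj₁ (≤-antisym (a≤D j) (≮⇒≥ a≮D))

  row-zero : ∀ j → p j ≡ 0 → a j ≡ 0 ⊎ a j ≡ 1
  row-zero j p≡0 = n≤1⇒n≡0∨n≡1 (subst (λ y → a j ≤ suc y) p≡0 (a≤1+p j))

  row-one : 1 ≤ D → ∀ j → p j ≡ 1 → a j ≡ 1 ⊎ a j ≡ 2
  row-one 1≤D j p≡1 = squeeze₁ 1≤a (subst (λ y → a j ≤ suc y) p≡1 (a≤1+p j))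
    where
    1≤a : 1 ≤ a j
    1≤a with a j <? D
    ... | yes a<D = subst (_≤ a j) p≡1 (a<D⇒p≤a j a<D)
    ... | no a≮D = ≤-trans 1≤D (≮⇒≥ a≮D)

  a-bound : ∀ {i j y} → i ≤ j → p j ≡ y + p i → a j ≤ suc y + a i
  a-bound {i} {j} {y} i≤j pⱼ≡y+pᵢ with a i <? D
  ... | yes a<D = ≤-trans (a≤1+p j) (s≤s (subst (_≤ y + a i) (sym pⱼ≡y+pᵢ)
                                            (+-monoʳ-≤ y (a<D⇒p≤a i a<D))))
  ... | no a≮D = ≤-trans (a≤D j) (≤-trans (≮⇒≥ a≮D) (m≤n+m (a i) (suc y)))

  same-row : ∀ {i j} → i ≤ j → p j ≡ p i → a j ≡ a i ⊎ a j ≡ suc (a i)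
  same-row i≤j pⱼ≡pᵢ = squeeze₁ (proj₁ (monotone i≤j)) (a-bound i≤j pⱼ≡pᵢ)

  next-row : ∀ {i j} → i ≤ j → p j ≡ suc (p i) →
    a j ≡ a i ⊎ a j ≡ suc (a i) ⊎ a j ≡ 2 + a i
  next-row i≤j pⱼ≡1+pᵢ = squeeze₂ (proj₁ (monotone i≤j)) (a-bound i≤j pⱼ≡1+pᵢ)

  module Run {K : ℕ} (D≤K : D ≤ K) where

    -- a step beyond row K would have a = D and hence index beyond K + D
    p≤K : ∀ j → j ≤ K + D → p j ≤ K
    p≤K j j≤K+D with p j ≤? K
    ... | yes p≤K = p≤K
    ... | no p≰K = contradiction j≤K+D (<⇒≱ (begin-strict
          K + D      ≡⟨ +-comm K D ⟩
          D + K      <⟨ +-monoʳ-< D (≰⇒> p≰K) ⟩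
          D + p j    ≡⟨ cong (_+ p j) (sym (on-top j (≤-trans D≤K (<⇒≤ (≰⇒> p≰K))))) ⟩
          a j + p j  ≡⟨ a+p≡j j ⟩
          j          ∎))
      where open ≤-Reasoning

    end-a : a (K + D) ≡ D
    end-a with a (K + D) <? D
    ... | yes a<D = contradiction (trans (a+p≡j (K + D)) (+-comm K D))
                      (<⇒≢ (+-mono-<-≤ a<D (p≤K (K + D) ≤-refl)))
    ... | no a≮D = ≤-antisym (a≤D (K + D)) (≮⇒≥ a≮D)

    end-p : p (K + D) ≡ K
    end-p = +-cancelˡ-≡ D (p (K + D)) K
              (trans (cong (_+ p (K + D)) (sym end-a)) (trans (a+p≡j (K + D)) (+-comm K D)))

module Extension {n K : ℕ} (q : ℕ) (P : FramedPath n K) (n≢2 : n ≢ 2)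
                 (D≤K : 2 + q * 4 ≤ K) where

  D : ℕ
  D = 2 + q * 4

  1≤K : 1 ≤ K
  1≤K = ≤-trans (s≤s z≤n) D≤K

  open FramedPath P renaming (vertex to X)
  open Staircase D
  open Run D≤K
  open BufferedPath n≢2 1≤K buffered

  X-step : ∀ i → i < K → Neighbour (X i) (X (suc i))
  X-step = proj₁ (proj₁ buffered)

  X-injective : ∀ i j → i ≤ K → j ≤ K → X i ≡ X j → i ≡ j
  X-injective = proj₂ (proj₁ buffered)

  K′ : ℕ
  K′ = K + D

  Y : ℕ → Transversal (2 + n)
  Y j = gray (a j) ++ X (p j)

  Y-distance : ∀ i j → diffCount (Y i) (Y j) ≡
    diffCount (gray (a i)) (gray (a j)) + diffCount (X (p i)) (X (p j))
  Y-distance i j = diffCount-++ (gray (a i)) (gray (a j)) (X (p i)) (X (p j))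

  Y-antidistance : ∀ i j → diffCount (Y i) (complement (Y j)) ≡
    diffCount (gray (a i)) (gray (2 + a j)) + diffCount (X (p i)) (complement (X (p j)))
  Y-antidistance i j = trans
    (cong (diffCount (Y i)) (trans (map-++ not (gray (a j)) (X (p j)))
                                   (cong (_++ complement (X (p j))) (gray-antipode (a j)))))
    (diffCount-++ (gray (a i)) (gray (2 + a j)) (X (p i)) (complement (X (p j))))

  rows : ∀ {j} → j ≤ K′ → p j ≤ K
  rows {j} = p≤K j

  row-0 : ∀ j → p j ≡ 0 → (j ≡ 0 × a j ≡ 0) ⊎ (j ≡ 1 × a j ≡ 1)
  row-0 j p≡0 with row-zero j p≡0
  ... | inj₁ a≡0 = inj₁ (index j a≡0 p≡0 , a≡0)
  ... | inj₂ a≡1 = inj₂ (index j a≡1 p≡0 , a≡1)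

  row-1 : ∀ j → p j ≡ 1 → a j ≡ 1 ⊎ a j ≡ 2
  row-1 = row-one (s≤s z≤n)

  row-K : ∀ j → p j ≡ K → j ≡ K′ × a j ≡ D
  row-K j p≡K = trans (index j a≡D p≡K) (+-comm D K) , a≡D
    where
    a≡D : a j ≡ D
    a≡D = on-top j (subst (D ≤_) (sym p≡K) D≤K)

  row-K∸1 : ∀ j → p j ≡ K ∸ 1 → (j ≡ K′ ∸ 1 × a j ≡ D) ⊎ suc (a j) ≡ D
  row-K∸1 j p≡K∸1 with near-top j (subst (D ≤_) (sym (trans (cong suc p≡K∸1) (suc[k∸1]≡k 1≤K))) D≤K)
  ... | inj₁ a≡D = inj₁ (trans (index j a≡D p≡K∸1) last-index , a≡D)
    where
    last-index : D + (K ∸ 1) ≡ K′ ∸ 1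
    last-index = trans (sym (+-∸-assoc D 1≤K)) (cong (_∸ 1) (+-comm D K))
  ... | inj₂ below = inj₂ below

  -- Y runs from all-x to all-y since a D-step arc of the cycle ends at gray 2 = y₁y₂
  Y-start : Y 0 ≡ allX (2 + n)
  Y-start = cong (λ v → false ∷ false ∷ v) starts

  Y-end : Y K′ ≡ allY (2 + n)
  Y-end = cong₂ _++_ (proj₁ (gray-top q end-a)) (trans (cong X end-p) ends)

  Y-at : ∀ j {x y} → a j ≡ x → p j ≡ y → Y j ≡ gray x ++ X y
  Y-at j ea ep = cong₂ (λ x y → gray x ++ X y) ea ep

  -- a step of the walk moves exactly one block by one edge
  Y-step : ∀ j → j < K′ → Neighbour (Y j) (Y (suc j))
  Y-step j j<K′ with step-cases j
  ... | inj₁ (ea , ep , _) =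
    trans (cong (diffCount (Y j)) (Y-at (suc j) ea ep))
      (trans (diffCount-++ (gray (a j)) (gray (suc (a j))) (X (p j)) (X (p j)))
             (cong₂ _+_ (gray-step (a j)) (diffCount-self (X (p j)))))
  ... | inj₂ (ea , ep , _) =
    trans (cong (diffCount (Y j)) (Y-at (suc j) ea ep))
      (trans (diffCount-++ (gray (a j)) (gray (a j)) (X (p j)) (X (suc (p j))))
             (cong₂ _+_ (diffCount-self (gray (a j)))
                        (X-step (p j) (subst (_≤ K) ep (rows {suc j} j<K′)))))

  same-row-cases : ∀ i j → p i ≡ p j →
    i ≡ j ⊎ (j ≡ suc i × a j ≡ suc (a i)) ⊎ (i ≡ suc j × a i ≡ suc (a j))
  same-row-cases i j pᵢ≡pⱼ with ≤-total i j
  ... | inj₁ i≤j with same-row i≤j (sym pᵢ≡pⱼ)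
  ...   | inj₁ aⱼ≡aᵢ = inj₁ (trans (index i (sym aⱼ≡aᵢ) pᵢ≡pⱼ) (a+p≡j j))
  ...   | inj₂ aⱼ≡1+aᵢ =
    inj₂ (inj₁ (trans (index j aⱼ≡1+aᵢ (sym pᵢ≡pⱼ)) (cong suc (a+p≡j i)) , aⱼ≡1+aᵢ))
  same-row-cases i j pᵢ≡pⱼ | inj₂ j≤i with same-row j≤i pᵢ≡pⱼ
  ...   | inj₁ aᵢ≡aⱼ = inj₁ (trans (index i aᵢ≡aⱼ pᵢ≡pⱼ) (a+p≡j j))
  ...   | inj₂ aᵢ≡1+aⱼ =
    inj₂ (inj₂ (trans (index i aᵢ≡1+aⱼ pᵢ≡pⱼ) (cong suc (a+p≡j j)) , aᵢ≡1+aⱼ))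

  rows-apart : ∀ i j → p j ≡ suc (p i) → gray (a i) ≡ gray (a j) → j ≡ suc i
  rows-apart i j pⱼ≡1+pᵢ g with ≤-total i j
  ... | inj₂ j≤i = contradiction (subst (_≤ p i) pⱼ≡1+pᵢ (proj₂ (monotone j≤i))) (n≮n (p i))
  ... | inj₁ i≤j with next-row i≤j pⱼ≡1+pᵢ
  ...   | inj₁ aⱼ≡aᵢ =
    trans (index j aⱼ≡aᵢ pⱼ≡1+pᵢ) (trans (+-suc (a i) (p i)) (cong suc (a+p≡j i)))
  ...   | inj₂ (inj₁ aⱼ≡1+aᵢ) = contradiction (trans g (cong gray aⱼ≡1+aᵢ)) (gray-moves₁ (a i))
  ...   | inj₂ (inj₂ aⱼ≡2+aᵢ) = contradiction (trans g (cong gray aⱼ≡2+aᵢ)) (gray-moves₂ (a i))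

  split-0 : ∀ i j → diffCount (Y i) (Y j) ≡ 0 → gray (a i) ≡ gray (a j) × X (p i) ≡ X (p j)
  split-0 i j d≡0 =
    diffCount≡0⇒≡ (gray (a i)) (gray (a j)) (m+n≡0⇒m≡0 _ d≡0′) ,
    diffCount≡0⇒≡ (X (p i)) (X (p j)) (m+n≡0⇒n≡0 (diffCount (gray (a i)) (gray (a j))) d≡0′)
    where
    d≡0′ : diffCount (gray (a i)) (gray (a j)) + diffCount (X (p i)) (X (p j)) ≡ 0
    d≡0′ = trans (sym (Y-distance i j)) d≡0

  -- distinct steps give distinct vertices: on one row of the walk the cycle block moves
  Y-injective : ∀ i j → i ≤ K′ → j ≤ K′ → Y i ≡ Y j → i ≡ j
  Y-injective i j i≤K′ j≤K′ Yᵢ≡Yⱼ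
    with split-0 i j (trans (cong (diffCount (Y i)) (sym Yᵢ≡Yⱼ)) (diffCount-self (Y i)))
  ... | g , x with same-row-cases i j (X-injective (p i) (p j) (rows i≤K′) (rows j≤K′) x)
  ...   | inj₁ i≡j = i≡j
  ...   | inj₂ (inj₁ (_ , aⱼ≡1+aᵢ)) =
    contradiction (trans g (cong gray aⱼ≡1+aᵢ)) (gray-moves₁ (a i))
  ...   | inj₂ (inj₂ (_ , aᵢ≡1+aⱼ)) =
    contradiction (trans (sym g) (cong gray aᵢ≡1+aⱼ)) (gray-moves₁ (a j))

  -- neighbours in Y differ in one block only, and in either case are consecutive steps
  Y-neighbours : ∀ i j → i ≤ K′ → j ≤ K′ → Neighbour (Y i) (Y j) → Adjacent i j
  Y-neighbours i j i≤K′ j≤K′ nb with sum≡1 _ _ (trans (sym (Y-distance i j)) nb)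
  ... | inj₁ (g≡0 , x∼) with neighbours-adjacent (p i) (p j) (rows i≤K′) (rows j≤K′) x∼
  ...   | inj₁ pⱼ≡1+pᵢ = inj₁ (rows-apart i j pⱼ≡1+pᵢ (diffCount≡0⇒≡ _ _ g≡0))
  ...   | inj₂ pᵢ≡1+pⱼ = inj₂ (rows-apart j i pᵢ≡1+pⱼ (sym (diffCount≡0⇒≡ _ _ g≡0)))
  Y-neighbours i j i≤K′ j≤K′ nb | inj₂ (g∼ , x≡0)
    with same-row-cases i j
           (X-injective (p i) (p j) (rows i≤K′) (rows j≤K′) (diffCount≡0⇒≡ _ _ x≡0))
  ... | inj₁ refl = contradiction (trans (sym (diffCount-self (gray (a i)))) g∼) 0≢1+n
  ... | inj₂ (inj₁ (j≡1+i , _)) = inj₁ j≡1+i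
  ... | inj₂ (inj₂ (i≡1+j , _)) = inj₂ i≡1+j

  antisplit-0 : ∀ i j → diffCount (Y i) (complement (Y j)) ≡ 0 →
    gray (a i) ≡ gray (2 + a j) × X (p i) ≡ complement (X (p j))
  antisplit-0 i j d≡0 =
    diffCount≡0⇒≡ (gray (a i)) (gray (2 + a j)) (m+n≡0⇒m≡0 _ d≡0′) ,
    diffCount≡0⇒≡ (X (p i)) (complement (X (p j)))
      (m+n≡0⇒n≡0 (diffCount (gray (a i)) (gray (2 + a j))) d≡0′)
    where
    d≡0′ : diffCount (gray (a i)) (gray (2 + a j)) + diffCount (X (p i)) (complement (X (p j))) ≡ 0
    d≡0′ = trans (sym (Y-antidistance i j)) d≡0

  top : ∀ {x} → x ≡ D → gray x ≡ gray 2 × gray (2 + x) ≡ gray 0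
  top = gray-top q

  below-top : ∀ {x} → suc x ≡ D → gray x ≡ gray 1 × gray (2 + x) ≡ gray 3
  below-top = gray-below-top q

  clash : ∀ {u v w z : Vec Bool 2} → u ≡ w → u ≡ v → v ≡ z → w ≡ z
  clash u≡w u≡v v≡z = trans (sym u≡w) (trans u≡v v≡z)

  opposite : ∀ {x y} → x ≡ y → gray (2 + x) ≡ gray (2 + y)
  opposite = cong (λ x → gray (2 + x))

  -- X_(p i) and E − X_(p j) are neighbours only near the ends of X; there the cycle
  -- blocks of Y_i and E − Y_j agree only when (i , j) is (0 , K′ − 1) or (K′ − 1 , 0).
  matching-near-ends : ∀ i j → gray (a i) ≡ gray (2 + a j) →
    NearEnds K (p i) (p j) → NearEnds K′ i j
  matching-near-ends i j g (inj₁ (pᵢ≡1 , pⱼ≡K)) with row-1 i pᵢ≡1 | row-K j pⱼ≡K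
  ... | inj₁ aᵢ≡1 | _ , aⱼ≡D = contradiction (clash (cong gray aᵢ≡1) g (proj₂ (top aⱼ≡D))) λ ()
  ... | inj₂ aᵢ≡2 | _ , aⱼ≡D = contradiction (clash (cong gray aᵢ≡2) g (proj₂ (top aⱼ≡D))) λ ()
  matching-near-ends i j g (inj₂ (inj₁ (pᵢ≡K , pⱼ≡1))) with row-K i pᵢ≡K | row-1 j pⱼ≡1
  ... | _ , aᵢ≡D | inj₁ aⱼ≡1 = contradiction (clash (proj₁ (top aᵢ≡D)) g (opposite aⱼ≡1)) λ ()
  ... | _ , aᵢ≡D | inj₂ aⱼ≡2 = contradiction (clash (proj₁ (top aᵢ≡D)) g (opposite aⱼ≡2)) λ ()
  matching-near-ends i j g (inj₂ (inj₂ (inj₁ (pᵢ≡0 , pⱼ≡K∸1)))) with row-0 i pᵢ≡0 | row-K∸1 j pⱼ≡K∸1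
  ... | inj₁ (i≡0 , _) | inj₁ (j≡K′∸1 , _) = inj₂ (inj₂ (inj₁ (i≡0 , j≡K′∸1)))
  ... | inj₁ (_ , aᵢ≡0) | inj₂ 1+aⱼ≡D =
    contradiction (clash (cong gray aᵢ≡0) g (proj₂ (below-top 1+aⱼ≡D))) λ ()
  ... | inj₂ (_ , aᵢ≡1) | inj₁ (_ , aⱼ≡D) =
    contradiction (clash (cong gray aᵢ≡1) g (proj₂ (top aⱼ≡D))) λ ()
  ... | inj₂ (_ , aᵢ≡1) | inj₂ 1+aⱼ≡D =
    contradiction (clash (cong gray aᵢ≡1) g (proj₂ (below-top 1+aⱼ≡D))) λ ()
  matching-near-ends i j g (inj₂ (inj₂ (inj₂ (pᵢ≡K∸1 , pⱼ≡0)))) with row-K∸1 i pᵢ≡K∸1 | row-0 j pⱼ≡0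
  ... | inj₁ (i≡K′∸1 , _) | inj₁ (j≡0 , _) = inj₂ (inj₂ (inj₂ (i≡K′∸1 , j≡0)))
  ... | inj₁ (_ , aᵢ≡D) | inj₂ (_ , aⱼ≡1) =
    contradiction (clash (proj₁ (top aᵢ≡D)) g (opposite aⱼ≡1)) λ ()
  ... | inj₂ 1+aᵢ≡D | inj₁ (_ , aⱼ≡0) =
    contradiction (clash (proj₁ (below-top 1+aᵢ≡D)) g (opposite aⱼ≡0)) λ ()
  ... | inj₂ 1+aᵢ≡D | inj₂ (_ , aⱼ≡1) =
    contradiction (clash (proj₁ (below-top 1+aᵢ≡D)) g (opposite aⱼ≡1)) λ ()

  -- X_(p i) and X_(p j) are antipodal only at the ends of X; there the cycle blocks of
  -- Y_i and E − Y_j are neighbours only when (i , j) is (1 , K′) or (K′ , 1).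
  neighbouring-antipodes : ∀ i j → Neighbour (gray (a i)) (gray (2 + a j)) →
    (p i ≡ 0 × p j ≡ K) ⊎ (p i ≡ K × p j ≡ 0) → NearEnds K′ i j
  neighbouring-antipodes i j g∼ (inj₁ (pᵢ≡0 , pⱼ≡K)) with row-0 i pᵢ≡0 | row-K j pⱼ≡K
  ... | inj₁ (_ , aᵢ≡0) | _ , aⱼ≡D =
    contradiction (subst₂ Neighbour (cong gray aᵢ≡0) (proj₂ (top aⱼ≡D)) g∼) λ ()
  ... | inj₂ (i≡1 , _) | j≡K′ , _ = inj₁ (i≡1 , j≡K′)
  neighbouring-antipodes i j g∼ (inj₂ (pᵢ≡K , pⱼ≡0)) with row-K i pᵢ≡K | row-0 j pⱼ≡0
  ... | _ , aᵢ≡D | inj₁ (_ , aⱼ≡0) =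
    contradiction (subst₂ Neighbour (proj₁ (top aᵢ≡D)) (opposite aⱼ≡0) g∼) λ ()
  ... | i≡K′ , _ | inj₂ (j≡1 , _) = inj₂ (inj₁ (i≡K′ , j≡1))

  Y-antineighbours : ∀ i j → i ≤ K′ → j ≤ K′ → Neighbour (Y i) (complement (Y j)) → NearEnds K′ i j
  Y-antineighbours i j i≤K′ j≤K′ nb with sum≡1 _ _ (trans (sym (Y-antidistance i j)) nb)
  ... | inj₁ (g≡0 , x∼) = matching-near-ends i j (diffCount≡0⇒≡ _ _ g≡0)
          (antineighbours-near-ends (p i) (p j) (rows i≤K′) (rows j≤K′) x∼)
  ... | inj₂ (g∼ , x≡0) = neighbouring-antipodes i j g∼
          (antipodes (p i) (p j) (rows i≤K′) (rows j≤K′) (diffCount≡0⇒≡ _ _ x≡0))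

  Y-antipodes : ∀ i j → i ≤ K′ → j ≤ K′ → Y i ≡ complement (Y j) →
    (i ≡ 0 × j ≡ K′) ⊎ (i ≡ K′ × j ≡ 0)
  Y-antipodes i j i≤K′ j≤K′ Yᵢ≡Ȳⱼ
    with antisplit-0 i j (trans (cong (diffCount (Y i)) (sym Yᵢ≡Ȳⱼ)) (diffCount-self (Y i)))
  ... | g , x with antipodes (p i) (p j) (rows i≤K′) (rows j≤K′) x
  ...   | inj₁ (pᵢ≡0 , pⱼ≡K) with row-0 i pᵢ≡0 | row-K j pⱼ≡K
  ...     | inj₁ (i≡0 , _) | j≡K′ , _ = inj₁ (i≡0 , j≡K′)
  ...     | inj₂ (_ , aᵢ≡1) | _ , aⱼ≡D =
    contradiction (clash (cong gray aᵢ≡1) g (proj₂ (top aⱼ≡D))) λ ()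
  Y-antipodes i j i≤K′ j≤K′ Yᵢ≡Ȳⱼ | g , x | inj₂ (pᵢ≡K , pⱼ≡0) with row-K i pᵢ≡K | row-0 j pⱼ≡0
  ...     | i≡K′ , _ | inj₁ (j≡0 , _) = inj₂ (i≡K′ , j≡0)
  ...     | _ , aᵢ≡D | inj₂ (_ , aⱼ≡1) =
    contradiction (clash (proj₁ (top aᵢ≡D)) g (opposite aⱼ≡1)) λ ()

  Y-close : ∀ i j → i ≤ K′ → j ≤ K′ →
    (Neighbour (Y i) (Y j) ⊎ Neighbour (Y i) (complement (Y j))) → AllowedPair K′ i j
  Y-close i j i≤K′ j≤K′ (inj₁ nb) = adjacent⇒allowed (Y-neighbours i j i≤K′ j≤K′ nb)
  Y-close i j i≤K′ j≤K′ (inj₂ nb) = near-ends⇒allowed (Y-antineighbours i j i≤K′ j≤K′ nb)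

  extended : FramedPath (2 + n) K′
  extended = record
    { vertex = Y
    ; buffered = (Y-step , Y-injective) , allY≡complement-allX Y-start Y-end , Y-close
    ; starts = Y-start
    ; ends = Y-end
    ; antipodes = Y-antipodes }

extend : ∀ {n K} q → n ≢ 2 → 2 + q * 4 ≤ K → FramedPath n K → FramedPath (2 + n) (K + (2 + q * 4))
extend q n≢2 D≤K P = Extension.extended q P n≢2 D≤K

-- w k = (4^k − 1)/3, so that 4^k = 1 + 3 w k.
w : ℕ → ℕ
w zero = 0
w (suc k) = 1 + w k * 4

4^k≡1+3w : ∀ k → 2 ^ (k * 2) ≡ 1 + w k * 3
4^k≡1+3w zero = refl
4^k≡1+3w (suc k) = begin
  2 * (2 * 2 ^ (k * 2))     ≡⟨ cong (λ x → 2 * (2 * x)) (4^k≡1+3w k) ⟩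
  2 * (2 * (1 + w k * 3))   ≡⟨ identity (w k) ⟩
  1 + (1 + w k * 4) * 3     ∎
  where
  open ≡-Reasoning
  identity : ∀ x → 2 * (2 * (1 + x * 3)) ≡ 1 + (1 + x * 4) * 3
  identity = solve-∀

f-odd : ∀ k → f (1 + k * 2) ≡ 2 + w k * 4
f-odd k = begin
  f (1 + k * 2)                      ≡⟨ odd-branch (1 + k * 2) ([m+kn]%n≡m%n 1 k 2) ⟩
  (2 ^ (1 + k * 2 + 1) + 2) / 3      ≡⟨ cong (λ e → (2 ^ e + 2) / 3) (+-comm (1 + k * 2) 1) ⟩
  (2 * (2 * 2 ^ (k * 2)) + 2) / 3    ≡⟨ cong (λ x → (2 * (2 * x) + 2) / 3) (4^k≡1+3w k) ⟩
  (2 * (2 * (1 + w k * 3)) + 2) / 3  ≡⟨ cong (_/ 3) (identity (w k)) ⟩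
  (2 + w k * 4) * 3 / 3              ≡⟨ m*n/n≡m (2 + w k * 4) 3 ⟩
  2 + w k * 4                        ∎
  where
  open ≡-Reasoning
  odd-branch : ∀ m → m % 2 ≡ 1 → f m ≡ (2 ^ (m + 1) + 2) / 3
  odd-branch m m%2≡1 rewrite m%2≡1 = refl
  identity : ∀ x → 2 * (2 * (1 + x * 3)) + 2 ≡ (2 + x * 4) * 3
  identity = solve-∀

f-even : ∀ k → f (2 + k * 2) ≡ 4 + w k * 8
f-even k = begin
  f (2 + k * 2)                            ≡⟨ even-branch (2 + k * 2) ([m+kn]%n≡m%n 0 (suc k) 2) ⟩
  (2 ^ (2 + k * 2 + 1) + 4) / 3            ≡⟨ cong (λ e → (2 ^ e + 4) / 3) (+-comm (2 + k * 2) 1) ⟩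
  (2 * (2 * (2 * 2 ^ (k * 2))) + 4) / 3    ≡⟨ cong (λ x → (2 * (2 * (2 * x)) + 4) / 3) (4^k≡1+3w k) ⟩
  (2 * (2 * (2 * (1 + w k * 3))) + 4) / 3  ≡⟨ cong (_/ 3) (identity (w k)) ⟩
  (4 + w k * 8) * 3 / 3                    ≡⟨ m*n/n≡m (4 + w k * 8) 3 ⟩
  4 + w k * 8                              ∎
  where
  open ≡-Reasoning
  even-branch : ∀ m → m % 2 ≡ 0 → f m ≡ (2 ^ (m + 1) + 4) / 3
  even-branch m m%2≡0 rewrite m%2≡0 = refl
  identity : ∀ x → 2 * (2 * (2 * (1 + x * 3))) + 4 ≡ (4 + x * 8) * 3
  identity = solve-∀

-- Framed paths in H_(2m) of length f(m), built by alternately extending: from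
-- H_(4+4k) to H_(6+4k) with D = K − 2, and from H_(2+4k) to H_(4+4k) with D = K.
oddPath : ∀ k → FramedPath (2 + k * 4) (2 + w k * 4)
evenPath : ∀ k → FramedPath (4 + k * 4) (4 + w k * 8)

oddPath zero = ascendingPath 2
oddPath (suc k) = subst (FramedPath (6 + k * 4)) (length (w k))
  (extend (w k * 2) (λ ()) (D≤K (w k)) (evenPath k))
  where
  D≤K : ∀ x → 2 + x * 2 * 4 ≤ 4 + x * 8
  D≤K x = subst (λ y → 2 + y ≤ 4 + x * 8) (sym (*-assoc x 2 4)) (+-monoˡ-≤ (x * 8) (s≤s (s≤s z≤n)))
  length : ∀ x → 4 + x * 8 + (2 + x * 2 * 4) ≡ 2 + (1 + x * 4) * 4
  length = solve-∀

evenPath zero = ascendingPath 4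
evenPath (suc k) = subst (FramedPath (8 + k * 4)) (length (w (suc k)))
  (extend (w (suc k)) (λ ()) ≤-refl (oddPath (suc k)))
  where
  length : ∀ x → 2 + x * 4 + (2 + x * 4) ≡ 4 + x * 8
  length = solve-∀

odd-or-even : ∀ m → 1 ≤ m → (Σ ℕ λ k → m ≡ 1 + k * 2) ⊎ (Σ ℕ λ k → m ≡ 2 + k * 2)
odd-or-even (suc zero) _ = inj₁ (0 , refl)
odd-or-even (suc (suc zero)) _ = inj₂ (0 , refl)
odd-or-even (suc (suc (suc m))) _ with odd-or-even (suc m) (s≤s z≤n)
... | inj₁ (k , e) = inj₁ (suc k , cong (2 +_) e)
... | inj₂ (k , e) = inj₂ (suc k , cong (2 +_) e)

forget-antipodes : ∀ {n K} → FramedPath n K →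
  Σ (ℕ → Transversal n) (λ X → IsBuffered K X × (X 0 ≡ allX n) × (X K ≡ allY n))
forget-antipodes P = vertex , buffered , starts , ends
  where open FramedPath P

lemma7 : (m : ℕ) → 1 Data.Nat.≤ m →
    Σ (ℕ → Transversal (2 * m)) (λ X →
      IsBuffered (f m) X × (X 0 ≡ allX (2 * m)) × (X (f m) ≡ allY (2 * m)))
lemma7 m 1≤m with odd-or-even m 1≤m
... | inj₁ (k , refl) =
  forget-antipodes (subst₂ FramedPath (sym (dimension k)) (sym (f-odd k)) (oddPath k))
  where
  dimension : ∀ x → 2 * (1 + x * 2) ≡ 2 + x * 4
  dimension = solve-∀
... | inj₂ (k , refl) =
  forget-antipodes (subst₂ FramedPath (sym (dimension k)) (sym (f-even k)) (evenPath k))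
  where
  dimension : ∀ x → 2 * (2 + x * 2) ≡ 4 + x * 4
  dimension = solve-∀
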